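{- Let $G$ be a chordal graph with no universal vertex, let $s$ be a simplicial vertex of $G$, and let $K$ be a clique of $G^{s}$ with $K\subseteq N_G(s)$. (i) If $K$ has a witness, then $K$ has a witness that is a simplicial vertex of $G$. (ii) If $K$ has no witness, then $G^{s}$ contains an induced sun.
   Context: A vertex is simplicial if its closed neighbourhood is a clique. $G^{s}$ is the graph on $V(G)$ with edges: two vertices of $V(G)\setminus N_G[s]$ are adjacent iff adjacent in $G$; two distinct $u,v\in N_G[s]$ are adjacent iff $N_G(u)\cup N_G(v)\ne V(G)$; $u\in N_G[s]$ and $v\in V(G)\setminus N_G[s]$ are adjacent iff $N_G[v]\not\subseteq N_G[u]$. For a clique $K$ of $G^{s}$, a vertex $w\in V(G)\setminus N_G[s]$ is a witness of $K$ if $N_G[w]\cap K$ and $N_G[s]\cap K$ are disjoint and their union is $K$. The sun is the graph on six vertices consisting of a triangle $v_1v_2v_3$ and vertices $x_1,x_2,x_3$ with $x_i$ adjacent exactly to the two triangle vertices other than $v_i$. -}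

module Defs where

open import Data.Nat using (ℕ; zero; suc; _≤_)
open import Data.Fin using (Fin; toℕ)
open import Data.Fin.Subset using (Subset; _∈_; _∉_)
open import Data.Bool using (Bool; true; false; T; _∨_)
open import Data.Product using (Σ; ∃; _×_)
open import Data.Sum using (_⊎_)
open import Relation.Nullary using (¬_)
open import Data.Empty using (⊥)
open import Relation.Binary.PropositionalEquality using (_≡_; _≢_)
open import Function using (_⇔_)
open import Function.Definitions using (Injective)

record Graph : Set where
  field
    n     : ℕ
    adj   : Fin n → Fin n → Bool
    sym   : ∀ u v → adj u v ≡ adj v u
    irrefl : ∀ v → adj v v ≡ false

module _ (G : Graph) where
  open Graph G

  Adj : Fin n → Fin n → Set
  Adj u v = T (adj u v)

  InN : Fin n → Fin n → Set
  InN v u = Adj v u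

  InN[] : Fin n → Fin n → Set
  InN[] v u = u ≡ v ⊎ Adj v u

  Universal : Fin n → Set
  Universal v = ∀ u → u ≢ v → Adj v u

  NoUniversalVertex : Set
  NoUniversalVertex = ¬ (Σ (Fin n) Universal)

  Simplicial : Fin n → Set
  Simplicial v = ∀ u w → InN[] v u → InN[] v w → u ≢ w → Adj u w

  GsAdj : Fin n → Fin n → Fin n → Set
  GsAdj s u v =
      (¬ InN[] s u × ¬ InN[] s v × Adj u v)
    ⊎ (InN[] s u × InN[] s v × u ≢ v × ∃ λ w → ¬ InN u w × ¬ InN v w)
    ⊎ (InN[] s u × ¬ InN[] s v × ∃ λ w → InN[] v w × ¬ InN[] u w)
    ⊎ (¬ InN[] s u × InN[] s v × ∃ λ w → InN[] u w × ¬ InN[] v w)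

  GsClique : Fin n → Subset n → Set
  GsClique s K = ∀ u v → u ∈ K → v ∈ K → u ≢ v → GsAdj s u v

  Witness : Fin n → Subset n → Fin n → Set
  Witness s K w =
      ¬ InN[] s w
    × (∀ x → x ∈ K → InN[] w x → InN[] s x → ⊥)
    × (∀ x → x ∈ K → InN[] w x ⊎ InN[] s x)

InducedCopy : ∀ {m n} → (Fin m → Fin m → Set) → (Fin n → Fin n → Set) → Set
InducedCopy {m} {n} H R =
  Σ (Fin m → Fin n) λ f → Injective _≡_ _≡_ f
    × (∀ i j → i ≢ j → (H i j ⇔ R (f i) (f j)))

Consec : (k : ℕ) → Fin k → Fin k → Set
Consec k i j = suc (toℕ i) ≡ toℕ j ⊎ (suc (toℕ i) ≡ k × toℕ j ≡ 0)

CycAdj : (k : ℕ) → Fin k → Fin k → Set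
CycAdj k i j = Consec k i j ⊎ Consec k j i

Chordal : Graph → Set
Chordal G = ∀ k → 4 ≤ k → ¬ InducedCopy (CycAdj k) (Adj G)

-- the sun: triangle v1 v2 v3 = 0 1 2; x1 x2 x3 = 3 4 5, x_i adjacent to v_j for j ≠ i
sunE : ℕ → ℕ → Bool
sunE 0 1 = true
sunE 0 2 = true
sunE 1 2 = true
sunE 1 3 = true
sunE 2 3 = true
sunE 0 4 = true
sunE 2 4 = true
sunE 0 5 = true
sunE 1 5 = true
sunE _ _ = false

SunAdj : Fin 6 → Fin 6 → Set
SunAdj i j = T (sunE (toℕ i) (toℕ j) ∨ sunE (toℕ j) (toℕ i))

-- A chordal graph has a simplicial vertex outside the closed neighbourhood N[Q] of a clique Q
-- as soon as some vertex lies outside N[Q]. This Dirac-type fact is proved by induction on a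
-- vertex set U, for regions C ⊆ U whose boundary in U is a clique: if a vertex v of C or of the
-- boundary misses a vertex u of C, recurse into D ∪ N(D) ∩ U, where D is the component of u in
-- C ∖ N[v]. The boundary of D then lies in N[v] and is again a clique, since two non-adjacent
-- neighbours of v joined by a path avoiding N[v] would close an induced cycle of length at least 4.
-- Otherwise C together with its boundary is a clique and every vertex of C is simplicial in U.
--
-- (i) Applied to Q = {s} ∪ K and a witness, this gives a simplicial witness.
-- (ii) Without witnesses every vertex outside N[s] has a neighbour in K. Take a simplicial
-- z₁ ∉ N[s] with K ∩ N(z₁) ⊂-minimal and a ∈ K ∩ N(z₁), then a simplicial z₂ ∉ N[s] ∪ N(a) with
-- K ∩ N(z₂) ∖ N(z₁) ⊂-minimal; minimality of z₁ yields c ∈ K ∩ N(z₂) ∖ N(z₁). Since a and c are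
-- adjacent in G^s they have a common non-neighbour, which gives a simplicial z₃ ∉ N[s] ∪ N(a) ∪ N(c),
-- and minimality of z₂ yields d ∈ K ∩ N(z₃) ∖ (N(z₁) ∪ N(z₂)). In G^s, a c d is a triangle and a
-- simplicial z ∉ N[s] is adjacent to k ∈ K exactly when z ≁ k in G, so z₁, z₂, z₃ complete a sun.

{-# OPTIONS --safe #-}
module Submission where

open import Defs
open import Level using (0ℓ)
open import Data.Bool using (T; _∨_)
open import Data.Bool.Properties using (T?)
import Data.Empty as Empty
open import Data.Fin using (Fin; toℕ; splitAt; join)
open import Data.Fin.Patterns using (0F; 1F; 2F)
open import Data.Fin.Properties using (any?; all?; toℕ-injective; toℕ<n; join-splitAt) renaming (_≟_ to _≟ᶠ_)
open import Data.Fin.Subset using (Subset; _∈_; _∉_; _⊆_; _⊂_; _⊃_; _∪_; ⁅_⁆; ⊤; ⊥)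
open import Data.Fin.Subset.Induction using (⊂-wellFounded; ⊃-wellFounded)
open import Data.Fin.Subset.Properties
  using (_∈?_; _⊂?_; ∈⊤; ∉⊥; x∈⁅x⁆; x∈⁅y⁆⇒x≡y; x∈p∪q⁺; x∈p∪q⁻; p⊆p∪q)
open import Data.Nat using (ℕ; zero; suc; _+_; _≤_; _<_; z≤n; s≤s; _≤?_; _<?_; _≟_)
open import Data.Nat.Induction using (<-wellFounded)
open import Data.Nat.Properties
open import Data.Nat.Tactic.RingSolver using (solve-∀)
open import Data.Product using (Σ; ∃; _×_; _,_; proj₁; proj₂)
open import Data.Sum using (_⊎_; inj₁; inj₂; [_,_]′)
import Data.Sum as Sum
import Data.Unit as Unit
open import Data.Vec using (tabulate; lookup; _∷_; [])
open import Data.Vec.Properties using (lookup∘tabulate; []=⇒lookup; lookup⇒[]=)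
open import Function using (_∘_; id; const; _⇔_; mk⇔; Equivalence)
open import Function.Construct.Composition using (_⇔-∘_)
open import Function.Construct.Symmetry using (⇔-sym)
open import Induction.WellFounded using (Acc; acc)
open import Relation.Binary.Definitions using (tri<; tri≈; tri>)
open import Relation.Binary.PropositionalEquality using (_≡_; _≢_; refl; sym; trans; cong; subst; subst₂)
open import Relation.Nullary using (¬_; Dec; yes; no; does)
open import Relation.Nullary.Decidable
  using (map′; from-yes; dec-true; decidable-stable; _×-dec_; _⊎-dec_; _→-dec_; ¬?)
open import Relation.Nullary.Negation using (contradiction)
open import Relation.Unary using (Pred; Decidable)

setOf : ∀ {n} {P : Pred (Fin n) 0ℓ} → Decidable P → Subset n
setOf P? = tabulate (does ∘ P?)

module _ {n} {P : Pred (Fin n) 0ℓ} (P? : Decidable P) where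

  ∈-setOf⁺ : ∀ {x} → P x → x ∈ setOf P?
  ∈-setOf⁺ {x} px = lookup⇒[]= x _ (trans (lookup∘tabulate _ x) (dec-true (P? x) px))

  ∈-setOf⁻ : ∀ {x} → x ∈ setOf P? → P x
  ∈-setOf⁻ {x} x∈ with P? x | trans (sym (lookup∘tabulate (does ∘ P?) x)) ([]=⇒lookup x∈)
  ... | yes px | _ = px
  ... | no _ | ()

⊂-minimal : ∀ {m n} {P : Pred (Fin m) 0ℓ} → Decidable P → (S : Fin m → Subset n)
          → ∃ P → ∃ λ z → P z × ∀ {y} → P y → ¬ S y ⊂ S z
⊂-minimal {P = P} P? S (x , px) = go x px (⊂-wellFounded (S x))
  where
  go : ∀ x → P x → Acc _⊂_ (S x) → ∃ λ z → P z × ∀ {y} → P y → ¬ S y ⊂ S z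
  go x px (acc smaller) with any? (λ y → P? y ×-dec S y ⊂? S x)
  ... | yes (y , py , y⊂x) = go y py (smaller y⊂x)
  ... | no none = x , px , λ py y⊂x → none (_ , py , y⊂x)

⊄-witness : ∀ {n} {p q : Subset n} {x} → ¬ p ⊂ q → x ∈ q → x ∉ p → ∃ λ y → y ∈ p × y ∉ q
⊄-witness {p = p} {q} {x} p⊄q x∈q x∉p with any? (λ y → (y ∈? p) ×-dec ¬? (y ∈? q))
... | yes found = found
... | no none = contradiction p⊂q p⊄q
  where
  p⊆q : p ⊆ q
  p⊆q {y} y∈p = decidable-stable (y ∈? q) (λ y∉q → none (y , y∈p , y∉q))
  p⊂q : p ⊂ q
  p⊂q = p⊆q , x , x∈q , x∉p

ifWithin : ∀ {A : Set} → ℕ → (ℕ → A) → (ℕ → A) → ℕ → A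
ifWithin L f g t with t ≤? L
... | yes _ = f t
... | no _ = g t

module _ {A : Set} {L : ℕ} {f g : ℕ → A} where

  ifWithin-≤ : ∀ {t} → t ≤ L → ifWithin L f g t ≡ f t
  ifWithin-≤ {t} t≤L with t ≤? L
  ... | yes _ = refl
  ... | no t≰L = contradiction t≤L t≰L

  ifWithin-> : ∀ {t} → L < t → ifWithin L f g t ≡ g t
  ifWithin-> {t} L<t with t ≤? L
  ... | yes t≤L = contradiction t≤L (<⇒≱ L<t)
  ... | no _ = refl

-- CycAdj k i j is by definition CycN k (toℕ i) (toℕ j).
CycN : ℕ → ℕ → ℕ → Set
CycN k s t = (suc s ≡ t ⊎ (suc s ≡ k × t ≡ 0)) ⊎ (suc t ≡ s ⊎ (suc t ≡ k × s ≡ 0))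

CycN-sym : ∀ {k s t} → CycN k s t → CycN k t s
CycN-sym (inj₁ c) = inj₂ c
CycN-sym (inj₂ c) = inj₁ c

CycN-inner⇔ : ∀ {k s t} → s < t → suc t < k → CycN k s t ⇔ (suc s ≡ t)
CycN-inner⇔ {k} {s} {t} s<t t+1<k = mk⇔ to (inj₁ ∘ inj₁)
  where
  to : CycN k s t → suc s ≡ t
  to (inj₁ (inj₁ s+1≡t)) = s+1≡t
  to (inj₁ (inj₂ (_ , refl))) = contradiction s<t λ ()
  to (inj₂ (inj₁ refl)) = contradiction s<t (<-asym (n<1+n t))
  to (inj₂ (inj₂ (refl , _))) = contradiction t+1<k (<-irrefl refl)

CycN-closing⇔ : ∀ {k s t} → s < t → suc t ≡ k → CycN k s t ⇔ (suc s ≡ t ⊎ s ≡ 0)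
CycN-closing⇔ {k} {s} {t} s<t t+1≡k = mk⇔ to from
  where
  to : CycN k s t → suc s ≡ t ⊎ s ≡ 0
  to (inj₁ (inj₁ s+1≡t)) = inj₁ s+1≡t
  to (inj₁ (inj₂ (_ , refl))) = contradiction s<t λ ()
  to (inj₂ (inj₁ refl)) = contradiction s<t (<-asym (n<1+n t))
  to (inj₂ (inj₂ (_ , s≡0))) = inj₂ s≡0
  from : suc s ≡ t ⊎ s ≡ 0 → CycN k s t
  from (inj₁ s+1≡t) = inj₁ (inj₁ s+1≡t)
  from (inj₂ s≡0) = inj₂ (inj₂ (t+1≡k , s≡0))

module Chordality (G : Graph) where
  open Graph G using (n; adj; irrefl) renaming (sym to adj-sym)

  infix 4 _~_
  _~_ : Fin n → Fin n → Set
  _~_ = Adj G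

  ~-sym : ∀ {u v} → u ~ v → v ~ u
  ~-sym {u} {v} = subst T (adj-sym u v)

  ~-irrefl : ∀ {v} → ¬ v ~ v
  ~-irrefl {v} = subst T (irrefl v)

  ~⇒≢ : ∀ {u v} → u ~ v → u ≢ v
  ~⇒≢ u~u refl = ~-irrefl u~u

  ~∧≁⇒≢ : ∀ {z a c} → z ~ a → ¬ z ~ c → a ≢ c
  ~∧≁⇒≢ z~a z≁c refl = z≁c z~a

  _~?_ : ∀ u v → Dec (u ~ v)
  u ~? v = T? (adj u v)

  N[_]? : ∀ v x → Dec (InN[] G v x)
  N[ v ]? x = (x ≟ᶠ v) ⊎-dec (v ~? x)

  Clique : Pred (Fin n) 0ℓ → Set
  Clique P = ∀ x y → P x → P y → x ≢ y → x ~ y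

  simplicial-N[]⊆ : ∀ {z x y} → Simplicial G z → InN[] G z x → InN[] G z y → InN[] G x y
  simplicial-N[]⊆ {z} {x} {y} simp x∈N[z] y∈N[z] with y ≟ᶠ x
  ... | yes y≡x = inj₁ y≡x
  ... | no y≢x = inj₂ (simp x y x∈N[z] y∈N[z] (y≢x ∘ sym))

  simplicial? : ∀ z → Dec (Simplicial G z)
  simplicial? z = all? λ x → all? λ y →
    N[ z ]? x →-dec N[ z ]? y →-dec ¬? (x ≟ᶠ y) →-dec (x ~? y)

  no-universal⇒non-neighbour : NoUniversalVertex G → ∀ v → ∃ λ u → ¬ InN[] G v u
  no-universal⇒non-neighbour no-universal v =
    decidable-stable (any? λ u → ¬? (N[ v ]? u)) λ none →
      no-universal (v , λ u u≢v → decidable-stable (v ~? u) λ v≁u →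
        none (u , λ { (inj₁ u≡v) → u≢v u≡v ; (inj₂ v~u) → v≁u v~u }))

  -- Positions beyond len carry no information.
  record Walk (P : Pred (Fin n) 0ℓ) (a b : Fin n) : Set where
    field
      len    : ℕ
      at     : ℕ → Fin n
      start  : at 0 ≡ a
      end    : at len ≡ b
      step   : ∀ t → t < len → at t ~ at (suc t)
      inside : ∀ t → t ≤ len → P (at t)
  open Walk

  module _ {P : Pred (Fin n) 0ℓ} where

    [_]ʷ : ∀ {a} → P a → Walk P a a
    [ pa ]ʷ = record
      { len = 0 ; at = λ _ → _ ; start = refl ; end = refl ; step = λ _ () ; inside = λ _ _ → pa }

    _∷ʷ_ : ∀ {a b c} → P c × c ~ a → Walk P a b → Walk P c b
    _∷ʷ_ {c = c} (pc , c~a) W = record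
      { len = suc (len W) ; at = at′ ; start = refl ; end = end W ; step = step′ ; inside = inside′ }
      where
      at′ : ℕ → Fin n
      at′ zero = c
      at′ (suc t) = at W t
      step′ : ∀ t → t < suc (len W) → at′ t ~ at′ (suc t)
      step′ zero _ = subst (c ~_) (sym (start W)) c~a
      step′ (suc t) (s≤s t<L) = step W t t<L
      inside′ : ∀ t → t ≤ suc (len W) → P (at′ t)
      inside′ zero _ = pc
      inside′ (suc t) (s≤s t≤L) = inside W t t≤L

    _∷ʳʷ_ : ∀ {a b c} → Walk P a b → b ~ c × P c → Walk P a c
    _∷ʳʷ_ {c = c} W (b~c , pc) = record
      { len = suc L ; at = at′ ; start = trans (old z≤n) (start W)
      ; end = new ≤-refl ; step = step′ ; inside = inside′ }
      where
      L : ℕ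
      L = len W
      at′ : ℕ → Fin n
      at′ = ifWithin L (at W) (λ _ → c)
      old : ∀ {t} → t ≤ L → at′ t ≡ at W t
      old = ifWithin-≤
      new : ∀ {t} → L < t → at′ t ≡ c
      new = ifWithin->
      step′ : ∀ t → t < suc L → at′ t ~ at′ (suc t)
      step′ t t<1+L with m<1+n⇒m<n∨m≡n t<1+L
      ... | inj₁ t<L rewrite old (<⇒≤ t<L) | old t<L = step W t t<L
      ... | inj₂ refl rewrite old (≤-refl {L}) | new (≤-refl {suc L}) =
                              subst (_~ c) (sym (end W)) b~c
      inside′ : ∀ t → t ≤ suc L → P (at′ t)
      inside′ t t≤1+L with m≤n⇒m<n∨m≡n t≤1+L
      ... | inj₁ t<1+L rewrite old (m<1+n⇒m≤n t<1+L) = inside W t (m<1+n⇒m≤n t<1+L)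
      ... | inj₂ refl rewrite new (≤-refl {suc L}) = pc

  weaken : ∀ {P Q : Pred (Fin n) 0ℓ} {a b} → (∀ {x} → P x → Q x) → Walk P a b → Walk Q a b
  weaken P⇒Q W = record
    { len = len W ; at = at W ; start = start W ; end = end W ; step = step W
    ; inside = λ t t≤L → P⇒Q (inside W t t≤L) }

  module _ {P : Pred (Fin n) 0ℓ} {a b : Fin n} where

    Shortcut : Walk P a b → Set
    Shortcut W = ∃ λ j → j < suc (len W) × ∃ λ i → i < j × (suc i < j × (at W i ~ at W j ⊎ at W i ≡ at W j))

    shortcut? : (W : Walk P a b) → Dec (Shortcut W)
    shortcut? W = anyUpTo? (λ j → anyUpTo? (λ i → suc i <? j ×-dec (at W i ~? at W j ⊎-dec at W i ≟ᶠ at W j)) j)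
                           (suc (len W))

    bypass : (W : Walk P a b) (i d L′ : ℕ) → i < L′ → L′ + d ≡ len W → at W i ~ at W (suc i + d) → Walk P a b
    bypass W i d L′ i<L′ L′+d≡L chord = record
      { len = L′ ; at = at′ ; start = trans (old z≤n) (start W)
      ; end = trans (new i<L′) (trans (cong (at W) L′+d≡L) (end W)) ; step = step′ ; inside = inside′ }
      where
      at′ : ℕ → Fin n
      at′ = ifWithin i (at W) (λ t → at W (t + d))
      old : ∀ {t} → t ≤ i → at′ t ≡ at W t
      old = ifWithin-≤
      new : ∀ {t} → i < t → at′ t ≡ at W (t + d)
      new = ifWithin->
      L′≤L : L′ ≤ len W
      L′≤L = subst (L′ ≤_) L′+d≡L (m≤m+n L′ d)
      step′ : ∀ t → t < L′ → at′ t ~ at′ (suc t)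
      step′ t t<L′ with <-cmp t i
      ... | tri< t<i _ _ rewrite old (<⇒≤ t<i) | old t<i = step W t (<-≤-trans t<i (≤-trans (<⇒≤ i<L′) L′≤L))
      ... | tri≈ _ refl _ rewrite old (≤-refl {t}) | new (≤-refl {suc t}) = chord
      ... | tri> _ _ i<t rewrite new i<t | new (m<n⇒m<1+n i<t) =
            step W (t + d) (subst (t + d <_) L′+d≡L (+-monoˡ-< d t<L′))
      inside′ : ∀ t → t ≤ L′ → P (at′ t)
      inside′ t t≤L′ with ≤-<-connex t i
      ... | inj₁ t≤i rewrite old t≤i = inside W t (≤-trans t≤i (≤-trans (<⇒≤ i<L′) L′≤L))
      ... | inj₂ i<t rewrite new i<t = inside W (t + d) (subst (t + d ≤_) L′+d≡L (+-monoˡ-≤ d t≤L′))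

    truncate : (W : Walk P a b) (i : ℕ) → i ≤ len W → at W i ≡ b → Walk P a b
    truncate W i i≤L at-i≡b = record
      { len = i ; at = at W ; start = start W ; end = at-i≡b
      ; step = λ t t<i → step W t (<-≤-trans t<i i≤L) ; inside = λ t t≤i → inside W t (≤-trans t≤i i≤L) }

    -- A chord from i to j is taken directly; a vertex repeated at i and j is skipped by jumping
    -- from i to j + 1, or by stopping at i when j is the last position.
    shorten : (W : Walk P a b) → Shortcut W → Σ (Walk P a b) (λ W′ → len W′ < len W)
    shorten W (j , j<1+L , i , i<j , 2+i≤j , link)
      with m≤n⇒∃[o]m+o≡n 2+i≤j | m≤n⇒∃[o]m+o≡n (m<1+n⇒m≤n j<1+L) | link
    ... | e , refl | f , j+f≡L | inj₁ chord =
            bypass W i (suc e) (suc (i + f)) (s≤s (m≤m+n i f)) (trans (chord-length i e f) j+f≡L)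
                   (subst (λ k → at W i ~ at W k) (sym (+-suc (suc i) e)) chord)
          , subst (suc (i + f) <_) (trans (chord-length i e f) j+f≡L) (m<m+n (suc (i + f)) (s≤s z≤n))
      where
      chord-length : ∀ i e f → suc (i + f) + suc e ≡ suc (suc i) + e + f
      chord-length = solve-∀
    ... | e , refl | zero , j+0≡L | inj₂ repeat =
            truncate W i (≤-trans (<⇒≤ i<j) (m<1+n⇒m≤n j<1+L))
                     (trans repeat (trans (cong (at W) (trans (sym (+-identityʳ _)) j+0≡L)) (end W)))
          , <-≤-trans i<j (m<1+n⇒m≤n j<1+L)
    ... | e , refl | suc f′ , j+f≡L | inj₂ repeat =
            bypass W i (suc (suc e)) (suc (i + f′)) (s≤s (m≤m+n i f′)) (trans (repeat-length i e f′) j+f≡L)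
                   (subst (λ k → at W i ~ at W k) (sym (repeat-target i e))
                          (subst (_~ at W _) (sym repeat) (step W _ j<L)))
          , subst (suc (i + f′) <_) (trans (repeat-length i e f′) j+f≡L) (m<m+n (suc (i + f′)) (s≤s z≤n))
      where
      j<L : suc (suc i) + e < len W
      j<L = subst (suc (suc i) + e <_) j+f≡L (m<m+n _ (s≤s z≤n))
      repeat-length : ∀ i e f → suc (i + f) + suc (suc e) ≡ suc (suc i) + e + suc f
      repeat-length = solve-∀
      repeat-target : ∀ i e → suc i + suc (suc e) ≡ suc (suc (suc i) + e)
      repeat-target = solve-∀

    chordless : (W : Walk P a b) → Σ (Walk P a b) (λ W′ → ¬ Shortcut W′)
    chordless W = go W (<-wellFounded (len W))
      where
      go : (W : Walk P a b) → Acc _<_ (len W) → Σ (Walk P a b) (λ W′ → ¬ Shortcut W′)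
      go W (acc shorter) with shortcut? W
      ... | no none = W , none
      ... | yes sc with shorten W sc
      ...   | W′ , W′<W = go W′ (shorter W′<W)

    chordless-distinct : (W : Walk P a b) → ¬ Shortcut W → ∀ {s t} → s < t → t ≤ len W → at W s ≢ at W t
    chordless-distinct W none {s} {t} s<t t≤L with suc s ≟ t
    ... | yes refl = ~⇒≢ (step W s t≤L)
    ... | no s+1≢t = λ repeat → none (t , s≤s t≤L , s , s<t , ≤∧≢⇒< s<t s+1≢t , inj₂ repeat)

    chordless-adjacent⇔ : (W : Walk P a b) → ¬ Shortcut W → ∀ {s t} → s < t → t ≤ len W
                        → (suc s ≡ t) ⇔ (at W s ~ at W t)
    chordless-adjacent⇔ W none {s} {t} s<t t≤L = mk⇔ (λ { refl → step W s t≤L }) λ chord →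
      decidable-stable (suc s ≟ t) λ s+1≢t → none (t , s≤s t≤L , s , s<t , ≤∧≢⇒< s<t s+1≢t , inj₁ chord)

  two≤len : ∀ {P a b} → a ≢ b → ¬ a ~ b → (W : Walk P a b) → 2 ≤ len W
  two≤len a≢b a≁b W with len W | end W | step W
  ... | zero | a≡b | _ = contradiction (trans (sym (start W)) a≡b) a≢b
  ... | suc zero | at1≡b | steps = contradiction (subst₂ _~_ (start W) at1≡b (steps 0 (s≤s z≤n))) a≁b
  ... | suc (suc _) | _ | _ = s≤s (s≤s z≤n)

  induced-cycle : ∀ k (f : ℕ → Fin n) → (∀ {s t} → s < t → t < k → f s ≢ f t × (CycN k s t ⇔ f s ~ f t))
                → InducedCopy (CycAdj k) _~_
  induced-cycle k f ordered = f ∘ toℕ , injective , adjacency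
    where
    injective : ∀ {i j} → f (toℕ i) ≡ f (toℕ j) → i ≡ j
    injective {i} {j} fi≡fj with <-cmp (toℕ i) (toℕ j)
    ... | tri< i<j _ _ = contradiction fi≡fj (proj₁ (ordered i<j (toℕ<n j)))
    ... | tri≈ _ i≡j _ = toℕ-injective i≡j
    ... | tri> _ _ j<i = contradiction (sym fi≡fj) (proj₁ (ordered j<i (toℕ<n i)))
    adjacency : ∀ i j → i ≢ j → CycAdj k i j ⇔ f (toℕ i) ~ f (toℕ j)
    adjacency i j i≢j with <-cmp (toℕ i) (toℕ j)
    ... | tri< i<j _ _ = proj₂ (ordered i<j (toℕ<n j))
    ... | tri≈ _ i≡j _ = contradiction (toℕ-injective i≡j) i≢j
    ... | tri> _ _ j<i = mk⇔ (~-sym ∘ to ∘ CycN-sym) (CycN-sym ∘ from ∘ ~-sym)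
      where open Equivalence (proj₂ (ordered j<i (toℕ<n i)))

  Avoiding : Fin n → Fin n → Fin n → Pred (Fin n) 0ℓ
  Avoiding q a b x = InN[] G q x → x ≡ a ⊎ x ≡ b

  apex-cycle : ∀ {q a b} (W : Walk (Avoiding q a b) a b) → ¬ Shortcut W → a ≢ b → ¬ a ~ b → q ~ a → q ~ b
             → 4 ≤ 2 + len W × InducedCopy (CycAdj (2 + len W)) _~_
  apex-cycle {q} {a} {b} W none a≢b a≁b q~a q~b =
    s≤s (s≤s (two≤len a≢b a≁b W)) , induced-cycle (2 + L) cyc ordered
    where
    L : ℕ
    L = len W
    cyc : ℕ → Fin n
    cyc = ifWithin L (at W) (λ _ → q)
    old : ∀ {t} → t ≤ L → cyc t ≡ at W t
    old = ifWithin-≤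
    apex : cyc (suc L) ≡ q
    apex = ifWithin-> {L = L} ≤-refl
    only-start-is-a : ∀ {t} → t ≤ L → at W t ≡ a → t ≡ 0
    only-start-is-a {zero} _ _ = refl
    only-start-is-a {suc t} t≤L at≡a =
      contradiction (trans (start W) (sym at≡a)) (chordless-distinct W none (s≤s z≤n) t≤L)
    only-end-is-b : ∀ {t} → t ≤ L → at W t ≡ b → t ≡ L
    only-end-is-b t≤L at≡b with m≤n⇒m<n∨m≡n t≤L
    ... | inj₁ t<L = contradiction (trans at≡b (sym (end W))) (chordless-distinct W none t<L ≤-refl)
    ... | inj₂ t≡L = t≡L
    apex-distinct : ∀ {t} → t ≤ L → at W t ≢ q
    apex-distinct {t} t≤L at≡q with inside W t t≤L (inj₁ at≡q)
    ... | inj₁ at≡a = ~⇒≢ q~a (trans (sym at≡q) at≡a)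
    ... | inj₂ at≡b = ~⇒≢ q~b (trans (sym at≡q) at≡b)
    apex-adjacent⇔ : ∀ {t} → t ≤ L → (suc t ≡ suc L ⊎ t ≡ 0) ⇔ (at W t ~ q)
    apex-adjacent⇔ {t} t≤L = mk⇔ to from
      where
      to : suc t ≡ suc L ⊎ t ≡ 0 → at W t ~ q
      to (inj₁ refl) = subst (_~ q) (sym (end W)) (~-sym q~b)
      to (inj₂ refl) = subst (_~ q) (sym (start W)) (~-sym q~a)
      from : at W t ~ q → suc t ≡ suc L ⊎ t ≡ 0
      from t~q with inside W t t≤L (inj₂ (~-sym t~q))
      ... | inj₁ at≡a = inj₂ (only-start-is-a t≤L at≡a)
      ... | inj₂ at≡b = inj₁ (cong suc (only-end-is-b t≤L at≡b))
    ordered : ∀ {s t} → s < t → t < 2 + L → cyc s ≢ cyc t × (CycN (2 + L) s t ⇔ cyc s ~ cyc t)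
    ordered {s} {t} s<t t<2+L with m<1+n⇒m<n∨m≡n t<2+L
    ... | inj₁ t<1+L rewrite old (≤-trans (<⇒≤ s<t) (m<1+n⇒m≤n t<1+L)) | old (m<1+n⇒m≤n t<1+L) =
          chordless-distinct W none s<t (m<1+n⇒m≤n t<1+L) ,
          chordless-adjacent⇔ W none s<t (m<1+n⇒m≤n t<1+L) ⇔-∘ CycN-inner⇔ s<t (s≤s t<1+L)
    ... | inj₂ refl rewrite old (m<1+n⇒m≤n s<t) | apex =
          apex-distinct (m<1+n⇒m≤n s<t) , apex-adjacent⇔ (m<1+n⇒m≤n s<t) ⇔-∘ CycN-closing⇔ s<t refl

  N[]-sym : ∀ {u v} → InN[] G u v → InN[] G v u
  N[]-sym (inj₁ refl) = inj₁ refl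
  N[]-sym (inj₂ u~v) = inj₂ (~-sym u~v)

  Connected : Subset n → Set
  Connected D = ∀ {x y} → x ∈ D → y ∈ D → Walk (_∈ D) x y

  record Component (A : Subset n) (u : Fin n) : Set where
    field
      members   : Subset n
      ⊆A        : members ⊆ A
      ∋u        : u ∈ members
      closed    : ∀ {x y} → x ∈ members → y ∈ A → x ~ y → y ∈ members
      connected : Connected members

  component : ∀ {A u} → u ∈ A → Component A u
  component {A} {u} u∈A = grow ⁅ u ⁆ ⁅u⁆⊆A (x∈⁅x⁆ u) ⁅u⁆-connected (⊃-wellFounded ⁅ u ⁆)
    where
    ⁅u⁆⊆A : ⁅ u ⁆ ⊆ A
    ⁅u⁆⊆A x∈⁅u⁆ rewrite x∈⁅y⁆⇒x≡y u x∈⁅u⁆ = u∈A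
    ⁅u⁆-connected : Connected ⁅ u ⁆
    ⁅u⁆-connected x∈⁅u⁆ y∈⁅u⁆ with x∈⁅y⁆⇒x≡y u x∈⁅u⁆ | x∈⁅y⁆⇒x≡y u y∈⁅u⁆
    ... | refl | refl = [ x∈⁅u⁆ ]ʷ
    grow : ∀ R → R ⊆ A → u ∈ R → Connected R → Acc _⊃_ R → Component A u
    grow R R⊆A u∈R R-connected (acc larger)
      with any? (λ y → y ∈? A ×-dec ¬? (y ∈? R) ×-dec any? (λ x → x ∈? R ×-dec x ~? y))
    ... | no maximal = record
      { members = R ; ⊆A = R⊆A ; ∋u = u∈R ; connected = R-connected
      ; closed = λ {x} {y} x∈R y∈A x~y →
          decidable-stable (y ∈? R) λ y∉R → maximal (y , y∈A , y∉R , x , x∈R , x~y) }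
    ... | yes (y , y∈A , y∉R , x , x∈R , x~y) =
          grow (R ∪ ⁅ y ⁆) R+y⊆A (x∈p∪q⁺ (inj₁ u∈R)) R+y-connected (larger (p⊆p∪q ⁅ y ⁆ , y , y∈R+y , y∉R))
      where
      y∈R+y : y ∈ R ∪ ⁅ y ⁆
      y∈R+y = x∈p∪q⁺ (inj₂ (x∈⁅x⁆ y))
      old-or-y : ∀ {z} → z ∈ R ∪ ⁅ y ⁆ → z ∈ R ⊎ z ≡ y
      old-or-y z∈R+y with x∈p∪q⁻ R ⁅ y ⁆ z∈R+y
      ... | inj₁ z∈R = inj₁ z∈R
      ... | inj₂ z∈⁅y⁆ = inj₂ (x∈⁅y⁆⇒x≡y y z∈⁅y⁆)
      R+y⊆A : R ∪ ⁅ y ⁆ ⊆ A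
      R+y⊆A z∈R+y with old-or-y z∈R+y
      ... | inj₁ z∈R = R⊆A z∈R
      ... | inj₂ refl = y∈A
      widen : ∀ {a b} → Walk (_∈ R) a b → Walk (_∈ R ∪ ⁅ y ⁆) a b
      widen = weaken (p⊆p∪q ⁅ y ⁆)
      R+y-connected : Connected (R ∪ ⁅ y ⁆)
      R+y-connected z∈ w∈ with old-or-y z∈ | old-or-y w∈
      ... | inj₁ z∈R | inj₁ w∈R = widen (R-connected z∈R w∈R)
      ... | inj₁ z∈R | inj₂ refl = widen (R-connected z∈R x∈R) ∷ʳʷ (x~y , y∈R+y)
      ... | inj₂ refl | inj₁ w∈R = (y∈R+y , ~-sym x~y) ∷ʷ widen (R-connected x∈R w∈R)
      ... | inj₂ refl | inj₂ refl = [ y∈R+y ]ʷ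

  infix 4 _∈N[_] _∉N[_]
  _∈N[_] : Fin n → Subset n → Set
  x ∈N[ Q ] = ∃ λ q → q ∈ Q × InN[] G q x

  _∉N[_] : Fin n → Subset n → Set
  x ∉N[ Q ] = ¬ x ∈N[ Q ]

  _∈N[_]? : ∀ x Q → Dec (x ∈N[ Q ])
  x ∈N[ Q ]? = any? λ q → q ∈? Q ×-dec N[ q ]? x

  Boundary : Subset n → Subset n → Pred (Fin n) 0ℓ
  Boundary U C x = x ∈ U × x ∉ C × ∃ λ c → c ∈ C × c ~ x

  boundary? : ∀ U C → Decidable (Boundary U C)
  boundary? U C x = x ∈? U ×-dec ¬? (x ∈? C) ×-dec any? λ c → c ∈? C ×-dec c ~? x

  SimplicialIn : Subset n → Fin n → Set
  SimplicialIn U z = Clique (λ x → x ∈ U × InN[] G z x)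

  Gs-sym : ∀ {s u v} → GsAdj G s u v → GsAdj G s v u
  Gs-sym (inj₁ (u∉ , v∉ , u~v)) = inj₁ (v∉ , u∉ , ~-sym u~v)
  Gs-sym (inj₂ (inj₁ (u∈ , v∈ , u≢v , w , u≁w , v≁w))) = inj₂ (inj₁ (v∈ , u∈ , u≢v ∘ sym , w , v≁w , u≁w))
  Gs-sym (inj₂ (inj₂ (inj₁ (u∈ , v∉ , w)))) = inj₂ (inj₂ (inj₂ (v∉ , u∈ , w)))
  Gs-sym (inj₂ (inj₂ (inj₂ (u∉ , v∈ , w)))) = inj₂ (inj₂ (inj₁ (v∈ , u∉ , w)))

  Gs-inner : ∀ {s u v} → InN[] G s u → InN[] G s v → GsAdj G s u v → ∃ λ w → ¬ u ~ w × ¬ v ~ w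
  Gs-inner u∈ v∈ (inj₁ (u∉ , _)) = contradiction u∈ u∉
  Gs-inner u∈ v∈ (inj₂ (inj₁ (_ , _ , _ , common-non-neighbour))) = common-non-neighbour
  Gs-inner u∈ v∈ (inj₂ (inj₂ (inj₁ (_ , v∉ , _)))) = contradiction v∈ v∉
  Gs-inner u∈ v∈ (inj₂ (inj₂ (inj₂ (u∉ , _)))) = contradiction u∈ u∉

  Gs-outer : ∀ {s u v} → ¬ InN[] G s u → ¬ InN[] G s v → GsAdj G s u v → u ~ v
  Gs-outer u∉ v∉ (inj₁ (_ , _ , u~v)) = u~v
  Gs-outer u∉ v∉ (inj₂ (inj₁ (u∈ , _))) = contradiction u∈ u∉
  Gs-outer u∉ v∉ (inj₂ (inj₂ (inj₁ (u∈ , _)))) = contradiction u∈ u∉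
  Gs-outer u∉ v∉ (inj₂ (inj₂ (inj₂ (_ , v∈ , _)))) = contradiction v∈ v∉

  Gs-mixed⇔ : ∀ {s k z} → s ~ k → ¬ InN[] G s z → Simplicial G z → GsAdj G s k z ⇔ (¬ z ~ k)
  Gs-mixed⇔ {s} {k} {z} s~k z∉N[s] z-simplicial = mk⇔ to from
    where
    to : GsAdj G s k z → ¬ z ~ k
    to (inj₁ (k∉N[s] , _)) _ = k∉N[s] (inj₂ s~k)
    to (inj₂ (inj₁ (_ , z∈N[s] , _))) _ = z∉N[s] z∈N[s]
    to (inj₂ (inj₂ (inj₁ (_ , _ , x , x∈N[z] , x∉N[k])))) z~k =
      x∉N[k] (simplicial-N[]⊆ z-simplicial (inj₂ z~k) x∈N[z])
    to (inj₂ (inj₂ (inj₂ (k∉N[s] , _)))) _ = k∉N[s] (inj₂ s~k)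
    from : ¬ z ~ k → GsAdj G s k z
    from z≁k = inj₂ (inj₂ (inj₁ (inj₂ s~k , z∉N[s] , z , inj₁ refl , z∉N[k])))
      where
      z∉N[k] : ¬ InN[] G k z
      z∉N[k] (inj₁ refl) = z∉N[s] (inj₂ s~k)
      z∉N[k] (inj₂ k~z) = z≁k (~-sym k~z)

  module _ (chordal : Chordal G) where

    linked-neighbours-adjacent : ∀ {q a b d₁ d₂} → q ~ a → q ~ b → a ≢ b → a ~ d₁ → d₂ ~ b
                               → Walk (λ x → ¬ InN[] G q x) d₁ d₂ → a ~ b
    linked-neighbours-adjacent {q} {a} {b} q~a q~b a≢b a~d₁ d₂~b W₀ = decidable-stable (a ~? b) λ a≁b →
      let W , none = chordless ((inj₁ ∘ const refl , a~d₁) ∷ʷ (weaken avoid W₀ ∷ʳʷ (d₂~b , inj₂ ∘ const refl)))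
          4≤k , cycle = apex-cycle W none a≢b a≁b q~a q~b
      in chordal _ 4≤k cycle
      where
      avoid : ∀ {x} → ¬ InN[] G q x → Avoiding q a b x
      avoid x∉N[q] x∈N[q] = contradiction x∈N[q] x∉N[q]

    component-neighbours-adjacent : ∀ {Q D x y d₁ d₂} → Clique (_∈ Q) → (∀ {d} → d ∈ D → d ∉N[ Q ]) → Connected D
      → x ∈N[ Q ] → y ∈N[ Q ] → x ≢ y → d₁ ∈ D → x ~ d₁ → d₂ ∈ D → d₂ ~ y → x ~ y
    component-neighbours-adjacent {Q} {D} {x} {y} {d₁} {d₂} Q-clique D-far D-connected
      (qx , qx∈Q , x∈N[qx]) (qy , qy∈Q , y∈N[qy]) x≢y d₁∈D x~d₁ d₂∈D d₂~y =
      through qx∈Q qy∈Q (apex-adjacent qx∈Q x∈N[qx] d₁∈D x~d₁) (apex-adjacent qy∈Q y∈N[qy] d₂∈D (~-sym d₂~y))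
      where
      apex-adjacent : ∀ {q v d} → q ∈ Q → InN[] G q v → d ∈ D → v ~ d → q ~ v
      apex-adjacent q∈Q (inj₁ refl) d∈D v~d = contradiction (_ , q∈Q , inj₂ v~d) (D-far d∈D)
      apex-adjacent q∈Q (inj₂ q~v) _ _ = q~v
      path : ∀ {q} → q ∈ Q → Walk (λ v → ¬ InN[] G q v) d₁ d₂
      path q∈Q = weaken (λ d∈D d∈N[q] → D-far d∈D (_ , q∈Q , d∈N[q])) (D-connected d₁∈D d₂∈D)
      through : ∀ {qx qy} → qx ∈ Q → qy ∈ Q → qx ~ x → qy ~ y → x ~ y
      through {qx} {qy} qx∈Q qy∈Q qx~x qy~y with qx ≟ᶠ qy | qx ~? y | qy ~? x
      ... | yes refl | _ | _ = linked-neighbours-adjacent qx~x qy~y x≢y x~d₁ d₂~y (path qx∈Q)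
      ... | no _ | yes qx~y | _ = linked-neighbours-adjacent qx~x qx~y x≢y x~d₁ d₂~y (path qx∈Q)
      ... | no _ | no _ | yes qy~x = linked-neighbours-adjacent qy~x qy~y x≢y x~d₁ d₂~y (path qy∈Q)
      ... | no qx≢qy | no qx≁y | no qy≁x = contradiction (~-sym x~qy) qy≁x
        where
        y∉N[qx] : ¬ InN[] G qx y
        y∉N[qx] (inj₁ refl) = D-far d₂∈D (y , qx∈Q , inj₂ (~-sym d₂~y))
        y∉N[qx] (inj₂ qx~y) = qx≁y qx~y
        x~qy : x ~ qy
        x~qy = linked-neighbours-adjacent qx~x (Q-clique _ _ qx∈Q qy∈Q qx≢qy)
                 (λ { refl → D-far d₁∈D (x , qy∈Q , inj₂ x~d₁) }) x~d₁ (~-sym qy~y)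
                 (path qx∈Q ∷ʳʷ (d₂~y , y∉N[qx]))

    RegionsHaveSimplicial : Subset n → Set
    RegionsHaveSimplicial U =
      ∀ {C c₀} → C ⊆ U → c₀ ∈ C → Clique (Boundary U C) → ∃ λ z → z ∈ C × SimplicialIn U z

    -- The recursion goes into U′ = U ∩ (D ∪ N(D)) for the component D of u in C ∖ N[Q]:
    -- q₀ ∉ U′, and the boundary of D in U′ lies in N[Q], hence is a clique.
    simplicial-beyond : ∀ {U C Q q₀ u} → (∀ {U′} → U′ ⊂ U → RegionsHaveSimplicial U′)
      → C ⊆ U → Clique (_∈ Q) → q₀ ∈ Q → q₀ ∈ U → u ∈ C → u ∉N[ Q ] → (∀ {x} → Boundary U C x → x ∈N[ Q ])
      → ∃ λ z → z ∈ C × z ∉N[ Q ] × SimplicialIn U z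
    simplicial-beyond {U} {C} {Q} {q₀} {u} smaller C⊆U Q-clique q₀∈Q q₀∈U u∈C u-far boundary-near =
      lift (smaller U′⊂U D⊆U′ ∋u boundary′-clique)
      where
      A⁺ : Decidable (λ x → x ∈ C × x ∉N[ Q ])
      A⁺ x = x ∈? C ×-dec ¬? (x ∈N[ Q ]?)
      open Component (component {setOf A⁺} (∈-setOf⁺ A⁺ (u∈C , u-far))) renaming (members to D)
      D-inside : ∀ {x} → x ∈ D → x ∈ C × x ∉N[ Q ]
      D-inside = ∈-setOf⁻ A⁺ ∘ ⊆A
      U′⁺ : Decidable (λ x → x ∈ U × (x ∈ D ⊎ ∃ λ d → d ∈ D × d ~ x))
      U′⁺ x = x ∈? U ×-dec (x ∈? D ⊎-dec any? λ d → d ∈? D ×-dec d ~? x)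
      U′ : Subset n
      U′ = setOf U′⁺
      q₀∉U′ : q₀ ∉ U′
      q₀∉U′ q₀∈U′ with proj₂ (∈-setOf⁻ U′⁺ q₀∈U′)
      ... | inj₁ q₀∈D = proj₂ (D-inside q₀∈D) (q₀ , q₀∈Q , inj₁ refl)
      ... | inj₂ (d , d∈D , d~q₀) = proj₂ (D-inside d∈D) (q₀ , q₀∈Q , inj₂ (~-sym d~q₀))
      U′⊂U : U′ ⊂ U
      U′⊂U = proj₁ ∘ ∈-setOf⁻ U′⁺ , q₀ , q₀∈U , q₀∉U′
      D⊆U′ : D ⊆ U′
      D⊆U′ d∈D = ∈-setOf⁺ U′⁺ (C⊆U (proj₁ (D-inside d∈D)) , inj₁ d∈D)
      boundary′-near : ∀ {x} → Boundary U′ D x → x ∈N[ Q ]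
      boundary′-near {x} (x∈U′ , x∉D , d , d∈D , d~x) with x ∈? C
      ... | no x∉C = boundary-near (proj₁ (∈-setOf⁻ U′⁺ x∈U′) , x∉C , d , proj₁ (D-inside d∈D) , d~x)
      ... | yes x∈C = decidable-stable (x ∈N[ Q ]?) λ x-far → x∉D (closed d∈D (∈-setOf⁺ A⁺ (x∈C , x-far)) d~x)
      boundary′-clique : Clique (Boundary U′ D)
      boundary′-clique x y bx@(_ , _ , d₁ , d₁∈D , d₁~x) by@(_ , _ , d₂ , d₂∈D , d₂~y) x≢y =
        component-neighbours-adjacent Q-clique (proj₂ ∘ D-inside) connected
          (boundary′-near bx) (boundary′-near by) x≢y d₁∈D (~-sym d₁~x) d₂∈D d₂~y
      N[z]∩U⊆U′ : ∀ {z x} → z ∈ D → x ∈ U → InN[] G z x → x ∈ U′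
      N[z]∩U⊆U′ z∈D x∈U (inj₁ refl) = D⊆U′ z∈D
      N[z]∩U⊆U′ z∈D x∈U (inj₂ z~x) = ∈-setOf⁺ U′⁺ (x∈U , inj₂ (_ , z∈D , z~x))
      lift : (∃ λ z → z ∈ D × SimplicialIn U′ z) → ∃ λ z → z ∈ C × z ∉N[ Q ] × SimplicialIn U z
      lift (z , z∈D , simplicial′) =
        z , proj₁ (D-inside z∈D) , proj₂ (D-inside z∈D) ,
        λ x y (x∈U , x∈N[z]) (y∈U , y∈N[z]) →
          simplicial′ x y (N[z]∩U⊆U′ z∈D x∈U x∈N[z] , x∈N[z]) (N[z]∩U⊆U′ z∈D y∈U y∈N[z] , y∈N[z])

    simplicial-beyond-vertex : ∀ {U C v u} → (∀ {U′} → U′ ⊂ U → RegionsHaveSimplicial U′)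
      → C ⊆ U → v ∈ U → u ∈ C → ¬ InN[] G v u → (∀ {x} → Boundary U C x → InN[] G v x)
      → ∃ λ z → z ∈ C × SimplicialIn U z
    simplicial-beyond-vertex {v = v} {u} smaller C⊆U v∈U u∈C u∉N[v] boundary⊆N[v] =
      let z , z∈C , _ , simplicial = simplicial-beyond smaller C⊆U ⁅v⁆-clique (x∈⁅x⁆ v) v∈U u∈C u-far
                                       (λ b → v , x∈⁅x⁆ v , boundary⊆N[v] b)
      in z , z∈C , simplicial
      where
      ⁅v⁆-clique : Clique (_∈ ⁅ v ⁆)
      ⁅v⁆-clique x y x∈⁅v⁆ y∈⁅v⁆ = contradiction (trans (x∈⁅y⁆⇒x≡y v x∈⁅v⁆) (sym (x∈⁅y⁆⇒x≡y v y∈⁅v⁆)))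
      u-far : u ∉N[ ⁅ v ⁆ ]
      u-far (q , q∈⁅v⁆ , u∈N[q]) rewrite x∈⁅y⁆⇒x≡y v q∈⁅v⁆ = u∉N[v] u∈N[q]

    region-step-dominated : ∀ {U C c₀} → (∀ {U′} → U′ ⊂ U → RegionsHaveSimplicial U′)
      → C ⊆ U → c₀ ∈ C → Clique (Boundary U C) → (∀ {b c} → Boundary U C b → c ∈ C → InN[] G b c)
      → ∃ λ z → z ∈ C × SimplicialIn U z
    region-step-dominated {U} {C} {c₀} smaller C⊆U c₀∈C boundary-clique C⊆N[b]
      with any? (λ x → any? λ y → x ∈? C ×-dec y ∈? C ×-dec ¬? (x ≟ᶠ y) ×-dec ¬? (x ~? y))
    ... | yes (x , y , x∈C , y∈C , x≢y , x≁y) =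
          simplicial-beyond-vertex smaller C⊆U (C⊆U x∈C) y∈C y∉N[x] (λ b∈B → N[]-sym (C⊆N[b] b∈B x∈C))
      where
      y∉N[x] : ¬ InN[] G x y
      y∉N[x] (inj₁ y≡x) = x≢y (sym y≡x)
      y∉N[x] (inj₂ x~y) = x≁y x~y
    ... | no C-clique = c₀ , c₀∈C , simplicial
      where
      C~B : ∀ {c b} → c ∈ C → Boundary U C b → c ≢ b → c ~ b
      C~B c∈C b∈B c≢b with C⊆N[b] b∈B c∈C
      ... | inj₁ c≡b = contradiction c≡b c≢b
      ... | inj₂ b~c = ~-sym b~c
      in-region : ∀ {x} → x ∈ U → InN[] G c₀ x → x ∈ C ⊎ Boundary U C x
      in-region {x} x∈U x∈N[c₀] with x ∈? C | x∈N[c₀]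
      ... | yes x∈C | _ = inj₁ x∈C
      ... | no x∉C | inj₁ refl = contradiction c₀∈C x∉C
      ... | no x∉C | inj₂ c₀~x = inj₂ (x∈U , x∉C , c₀ , c₀∈C , c₀~x)
      simplicial : SimplicialIn U c₀
      simplicial x y (x∈U , x∈N[c₀]) (y∈U , y∈N[c₀]) x≢y with in-region x∈U x∈N[c₀] | in-region y∈U y∈N[c₀]
      ... | inj₁ x∈C | inj₁ y∈C = decidable-stable (x ~? y) λ x≁y → C-clique (x , y , x∈C , y∈C , x≢y , x≁y)
      ... | inj₁ x∈C | inj₂ y∈B = C~B x∈C y∈B x≢y
      ... | inj₂ x∈B | inj₁ y∈C = ~-sym (C~B y∈C x∈B (x≢y ∘ sym))
      ... | inj₂ x∈B | inj₂ y∈B = boundary-clique x y x∈B y∈B x≢y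

    region-step : ∀ {U} → (∀ {U′} → U′ ⊂ U → RegionsHaveSimplicial U′) → RegionsHaveSimplicial U
    region-step {U} smaller {C} {c₀} C⊆U c₀∈C boundary-clique
      with any? (λ v → boundary? U C v ×-dec any? λ c → c ∈? C ×-dec ¬? (N[ v ]? c))
    ... | yes (v , v∈B , c , c∈C , c∉N[v]) =
          simplicial-beyond-vertex smaller C⊆U (proj₁ v∈B) c∈C c∉N[v] boundary⊆N[v]
      where
      boundary⊆N[v] : ∀ {x} → Boundary U C x → InN[] G v x
      boundary⊆N[v] {x} x∈B with x ≟ᶠ v
      ... | yes x≡v = inj₁ x≡v
      ... | no x≢v = inj₂ (boundary-clique v x v∈B x∈B (x≢v ∘ sym))
    ... | no undominated = region-step-dominated smaller C⊆U c₀∈C boundary-clique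
          λ {b} {c} b∈B c∈C → decidable-stable (N[ b ]? c) λ c∉N[b] → undominated (b , b∈B , c , c∈C , c∉N[b])

    regions-have-simplicial : ∀ U → RegionsHaveSimplicial U
    regions-have-simplicial U = go U (⊂-wellFounded U)
      where
      go : ∀ U → Acc _⊂_ U → RegionsHaveSimplicial U
      go U (acc smaller) = region-step (λ U′⊂U → go _ (smaller U′⊂U))

    simplicial-outside : ∀ {Q q₀ y} → Clique (_∈ Q) → q₀ ∈ Q → y ∉N[ Q ] → ∃ λ z → Simplicial G z × z ∉N[ Q ]
    simplicial-outside Q-clique q₀∈Q y-far =
      let z , _ , z-far , simplicial = simplicial-beyond {U = ⊤} {C = ⊤} (λ _ → regions-have-simplicial _) id
                                         Q-clique q₀∈Q ∈⊤ ∈⊤ y-far (λ (_ , x∉⊤ , _) → contradiction ∈⊤ x∉⊤)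
      in z , (λ x y x∈N[z] y∈N[z] → simplicial x y (∈⊤ , x∈N[z]) (∈⊤ , y∈N[z])) , z-far

    simplicial-avoiding : ∀ {s K′ y} → Simplicial G s → (∀ {k} → k ∈ K′ → s ~ k)
      → ¬ InN[] G s y → (∀ {k} → k ∈ K′ → ¬ k ~ y)
      → ∃ λ z → Simplicial G z × ¬ InN[] G s z × (∀ {k} → k ∈ K′ → ¬ k ~ z)
    simplicial-avoiding {s} {K′} {y} s-simplicial K′⊆N[s] y∉N[s] y-far-from-K′ =
      let z , z-simplicial , z-far = simplicial-outside Q-clique (x∈p∪q⁺ (inj₁ (x∈⁅x⁆ s))) y-far
      in z , z-simplicial , (λ z∈N[s] → z-far (s , x∈p∪q⁺ (inj₁ (x∈⁅x⁆ s)) , z∈N[s]))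
           , (λ k∈K′ k~z → z-far (_ , x∈p∪q⁺ (inj₂ k∈K′) , inj₂ k~z))
      where
      Q : Subset n
      Q = ⁅ s ⁆ ∪ K′
      Q⊆N[s] : ∀ {q} → q ∈ Q → InN[] G s q
      Q⊆N[s] q∈Q with x∈p∪q⁻ ⁅ s ⁆ K′ q∈Q
      ... | inj₁ q∈⁅s⁆ = inj₁ (x∈⁅y⁆⇒x≡y s q∈⁅s⁆)
      ... | inj₂ q∈K′ = inj₂ (K′⊆N[s] q∈K′)
      Q-clique : Clique (_∈ Q)
      Q-clique x y x∈Q y∈Q = s-simplicial x y (Q⊆N[s] x∈Q) (Q⊆N[s] y∈Q)
      y-far : y ∉N[ Q ]
      y-far (q , q∈Q , y∈N[q]) with x∈p∪q⁻ ⁅ s ⁆ K′ q∈Q | y∈N[q]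
      ... | inj₁ q∈⁅s⁆ | _ rewrite x∈⁅y⁆⇒x≡y s q∈⁅s⁆ = y∉N[s] y∈N[q]
      ... | inj₂ q∈K′ | inj₁ refl = y∉N[s] (inj₂ (K′⊆N[s] q∈K′))
      ... | inj₂ q∈K′ | inj₂ q~y = y-far-from-K′ q∈K′ q~y

-- Through splitAt 3, inj₁ j is the triangle vertex v_{j+1} and inj₂ i the vertex x_{i+1} of the sun.
SunShape : Fin 3 ⊎ Fin 3 → Fin 3 ⊎ Fin 3 → Set
SunShape (inj₁ _) (inj₁ _) = Unit.⊤
SunShape (inj₁ j) (inj₂ i) = i ≢ j
SunShape (inj₂ i) (inj₁ j) = i ≢ j
SunShape (inj₂ _) (inj₂ _) = Empty.⊥

sunAdj⇔sunShape : ∀ i j → i ≢ j → SunAdj i j ⇔ SunShape (splitAt 3 i) (splitAt 3 j)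
sunAdj⇔sunShape = from-yes (all? λ i → all? λ j →
  ¬? (i ≟ᶠ j) →-dec (T? (sunE (toℕ i) (toℕ j) ∨ sunE (toℕ j) (toℕ i)) ⇔? shape? (splitAt 3 i) (splitAt 3 j)))
  where
  _⇔?_ : ∀ {A B : Set} → Dec A → Dec B → Dec (A ⇔ B)
  A? ⇔? B? = map′ (λ (to , from) → mk⇔ to from) (λ A⇔B → Equivalence.to A⇔B , Equivalence.from A⇔B)
                  ((A? →-dec B?) ×-dec (B? →-dec A?))
  shape? : ∀ p q → Dec (SunShape p q)
  shape? (inj₁ _) (inj₁ _) = yes _
  shape? (inj₁ j) (inj₂ i) = ¬? (i ≟ᶠ j)
  shape? (inj₂ i) (inj₁ j) = ¬? (i ≟ᶠ j)
  shape? (inj₂ _) (inj₂ _) = no λ ()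

induced-sun : ∀ {m} {R : Fin m → Fin m → Set} (f : Fin 3 ⊎ Fin 3 → Fin m)
            → (∀ {p q} → f p ≡ f q → p ≡ q) → (∀ p q → p ≢ q → SunShape p q ⇔ R (f p) (f q))
            → InducedCopy SunAdj R
induced-sun f f-injective f-shape =
  f ∘ splitAt 3 , splitAt-injective ∘ f-injective ,
  λ i j i≢j → f-shape _ _ (i≢j ∘ splitAt-injective) ⇔-∘ sunAdj⇔sunShape i j i≢j
  where
  splitAt-injective : ∀ {i j : Fin 6} → splitAt 3 i ≡ splitAt 3 j → i ≡ j
  splitAt-injective {i} {j} eq =
    trans (sym (join-splitAt 3 3 i)) (trans (cong (join 3 3) eq) (join-splitAt 3 3 j))

module Lemma3p4 (G : Graph) (chordal : Chordal G) (no-universal : NoUniversalVertex G)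
                (s : Fin (Graph.n G)) (s-simplicial : Simplicial G s)
                (K : Subset (Graph.n G)) (K-clique : GsClique G s K) (K⊆N[s] : ∀ {x} → x ∈ K → InN G s x) where
  open Graph G using (n)
  open Chordality G

  Candidate : Pred (Fin n) 0ℓ
  Candidate z = ¬ InN[] G s z × Simplicial G z

  candidate? : Decidable Candidate
  candidate? z = ¬? (N[ s ]? z) ×-dec simplicial? z

  K≢outside : ∀ {k z} → k ∈ K → ¬ InN[] G s z → k ≢ z
  K≢outside k∈K z∉N[s] refl = z∉N[s] (inj₂ (K⊆N[s] k∈K))

  witness⇔ : ∀ {w} → Witness G s K w ⇔ (¬ InN[] G s w × ∀ {k} → k ∈ K → ¬ k ~ w)
  witness⇔ {w} = mk⇔ to from
    where
    to : Witness G s K w → ¬ InN[] G s w × ∀ {k} → k ∈ K → ¬ k ~ w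
    to (w∉N[s] , disjoint , _) = w∉N[s] , λ k∈K k~w → disjoint _ k∈K (inj₂ (~-sym k~w)) (inj₂ (K⊆N[s] k∈K))
    from : ¬ InN[] G s w × (∀ {k} → k ∈ K → ¬ k ~ w) → Witness G s K w
    from (w∉N[s] , K-far) = w∉N[s] , disjoint , λ x x∈K → inj₂ (inj₂ (K⊆N[s] x∈K))
      where
      disjoint : ∀ x → x ∈ K → InN[] G w x → InN[] G s x → Empty.⊥
      disjoint x x∈K (inj₁ refl) _ = K≢outside x∈K w∉N[s] refl
      disjoint x x∈K (inj₂ w~x) _ = K-far x∈K (~-sym w~x)

  candidate-avoiding : ∀ {K′ y} → K′ ⊆ K → ¬ InN[] G s y → (∀ {k} → k ∈ K′ → ¬ k ~ y)
                     → ∃ λ z → Candidate z × (∀ {k} → k ∈ K′ → ¬ k ~ z)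
  candidate-avoiding K′⊆K y∉N[s] y-far =
    let z , z-simplicial , z∉N[s] , z-far = simplicial-avoiding chordal s-simplicial (K⊆N[s] ∘ K′⊆K) y∉N[s] y-far
    in z , (z∉N[s] , z-simplicial) , z-far

  part-i : Σ (Fin n) (Witness G s K) → Σ (Fin n) (λ w → Witness G s K w × Simplicial G w)
  part-i (w , w-witness) =
    let w∉N[s] , w-far = Equivalence.to witness⇔ w-witness
        z , (z∉N[s] , z-simplicial) , z-far = candidate-avoiding id w∉N[s] w-far
    in z , Equivalence.from witness⇔ (z∉N[s] , z-far) , z-simplicial

  sun-from-pendants : (k z : Fin 3 → Fin n) → (∀ j → k j ∈ K) → (∀ i → Candidate (z i))
    → (∀ i → z i ~ k i) → (∀ i j → i ≢ j → ¬ z i ~ k j) → InducedCopy SunAdj (GsAdj G s)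
  sun-from-pendants k z k∈K z-candidate z~k z≁k = induced-sun {R = GsAdj G s} F F-injective F-shape
    where
    F : Fin 3 ⊎ Fin 3 → Fin n
    F = [ k , z ]′
    same-index : ∀ {i j} → z i ~ k j → i ≡ j
    same-index {i} {j} zi~kj = decidable-stable (i ≟ᶠ j) λ i≢j → z≁k i j i≢j zi~kj
    k≢z : ∀ {i j} → k j ≢ z i
    k≢z {i} {j} = K≢outside (k∈K j) (proj₁ (z-candidate i))
    F-injective : ∀ {p q} → F p ≡ F q → p ≡ q
    F-injective {inj₁ i} {inj₁ j} ki≡kj = cong inj₁ (same-index (subst (z i ~_) ki≡kj (z~k i)))
    F-injective {inj₁ _} {inj₂ _} kj≡zi = contradiction kj≡zi k≢z
    F-injective {inj₂ _} {inj₁ _} zi≡kj = contradiction (sym zi≡kj) k≢z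
    F-injective {inj₂ i} {inj₂ j} zi≡zj = cong inj₂ (same-index (subst (_~ k j) (sym zi≡zj) (z~k j)))
    pendants-nonadjacent : ∀ {i j} → i ≢ j → ¬ z i ~ z j
    pendants-nonadjacent {i} {j} i≢j zi~zj =
      z≁k j i (i≢j ∘ sym) (~-sym (proj₂ (z-candidate i) (k i) (z j) (inj₂ (z~k i)) (inj₂ zi~zj) k≢z))
    mixed : ∀ i j → (i ≢ j) ⇔ GsAdj G s (k j) (z i)
    mixed i j = ⇔-sym (Gs-mixed⇔ (K⊆N[s] (k∈K j)) (proj₁ (z-candidate i)) (proj₂ (z-candidate i)))
                ⇔-∘ mk⇔ (z≁k i j) (λ zi≁kj i≡j → zi≁kj (subst (λ j → z i ~ k j) i≡j (z~k i)))
    F-shape : ∀ p q → p ≢ q → SunShape p q ⇔ GsAdj G s (F p) (F q)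
    F-shape (inj₁ i) (inj₁ j) p≢q = mk⇔ (λ _ → K-clique _ _ (k∈K i) (k∈K j) (p≢q ∘ F-injective)) _
    F-shape (inj₁ j) (inj₂ i) _ = mixed i j
    F-shape (inj₂ i) (inj₁ j) _ =
      mk⇔ (Gs-sym ∘ Equivalence.to (mixed i j)) (Equivalence.from (mixed i j) ∘ Gs-sym)
    F-shape (inj₂ i) (inj₂ j) p≢q =
      mk⇔ (λ ()) (pendants-nonadjacent (p≢q ∘ cong inj₂)
                  ∘ Gs-outer (proj₁ (z-candidate i)) (proj₁ (z-candidate j)))

  N[s]⊆N[_] : ∀ {k x} → k ∈ K → InN[] G s x → InN[] G k x
  N[s]⊆N[ k∈K ] = simplicial-N[]⊆ s-simplicial (inj₂ (K⊆N[s] k∈K))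

  some-candidate : ∃ Candidate
  some-candidate =
    let y , y∉N[s] = no-universal⇒non-neighbour no-universal s
        z , z-candidate , _ = candidate-avoiding {K′ = ⊥} (λ k∈⊥ → contradiction k∈⊥ ∉⊥) y∉N[s]
                                (λ k∈⊥ → contradiction k∈⊥ ∉⊥)
    in z , z-candidate

  non-neighbour-outside : ∀ {a} → a ∈ K → ∃ λ y → ¬ InN[] G s y × ¬ a ~ y
  non-neighbour-outside {a} a∈K =
    let y , y∉N[a] = no-universal⇒non-neighbour no-universal a
    in y , y∉N[a] ∘ N[s]⊆N[ a∈K ] , y∉N[a] ∘ inj₂

  common-non-neighbour-outside : ∀ {a c w} → a ∈ K → c ∈ K → a ≢ c → ¬ a ~ w → ¬ c ~ w → ¬ InN[] G s w
  common-non-neighbour-outside a∈K c∈K a≢c a≁w c≁w w∈N[s] with N[s]⊆N[ a∈K ] w∈N[s]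
  ... | inj₁ refl = c≁w (s-simplicial _ _ (inj₂ (K⊆N[s] c∈K)) (inj₂ (K⊆N[s] a∈K)) (a≢c ∘ sym))
  ... | inj₂ a~w = a≁w a~w

  candidate-avoiding-pair : ∀ {a c y} → a ∈ K → c ∈ K → ¬ InN[] G s y → ¬ a ~ y → ¬ c ~ y
                          → ∃ λ z → Candidate z × ¬ a ~ z × ¬ c ~ z
  candidate-avoiding-pair {a} {c} {y} a∈K c∈K y∉N[s] a≁y c≁y =
    let z , z-candidate , z-far = candidate-avoiding pair⊆K y∉N[s] y-far
    in z , z-candidate , z-far (x∈p∪q⁺ (inj₁ (x∈⁅x⁆ a))) , z-far (x∈p∪q⁺ (inj₂ (x∈⁅x⁆ c)))
    where
    pair-member : ∀ {k} → k ∈ ⁅ a ⁆ ∪ ⁅ c ⁆ → k ≡ a ⊎ k ≡ c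
    pair-member = Sum.map (x∈⁅y⁆⇒x≡y a) (x∈⁅y⁆⇒x≡y c) ∘ x∈p∪q⁻ ⁅ a ⁆ ⁅ c ⁆
    pair⊆K : ⁅ a ⁆ ∪ ⁅ c ⁆ ⊆ K
    pair⊆K k∈pair with pair-member k∈pair
    ... | inj₁ refl = a∈K
    ... | inj₂ refl = c∈K
    y-far : ∀ {k} → k ∈ ⁅ a ⁆ ∪ ⁅ c ⁆ → ¬ k ~ y
    y-far k∈pair with pair-member k∈pair
    ... | inj₁ refl = a≁y
    ... | inj₂ refl = c≁y

  candidate-avoiding-one : ∀ {a} → a ∈ K → ∃ λ z → Candidate z × ¬ a ~ z
  candidate-avoiding-one a∈K =
    let y , y∉N[s] , a≁y = non-neighbour-outside a∈K
        z , z-candidate , a≁z , _ = candidate-avoiding-pair a∈K a∈K y∉N[s] a≁y a≁y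
    in z , z-candidate , a≁z

  neighbours : Fin n → Subset n
  neighbours z = setOf (z ~?_)

  KNeighbours? : ∀ X z → Decidable (λ x → x ∈ K × z ~ x × x ∉ X)
  KNeighbours? X z x = x ∈? K ×-dec z ~? x ×-dec ¬? (x ∈? X)

  KNeighbours : Subset n → Fin n → Subset n
  KNeighbours X z = setOf (KNeighbours? X z)

  escape : ∀ {X z z′ x} → ¬ KNeighbours X z′ ⊂ KNeighbours X z → x ∈ K → z ~ x → x ∉ X → ¬ z′ ~ x
         → ∃ λ y → y ∈ K × z′ ~ y × y ∉ X × ¬ z ~ y
  escape {X} {z} {z′} minimal x∈K z~x x∉X z′≁x =
    let y , y∈new , y∉old = ⊄-witness minimal (∈-setOf⁺ (KNeighbours? X z) (x∈K , z~x , x∉X))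
                                                (z′≁x ∘ proj₁ ∘ proj₂ ∘ ∈-setOf⁻ (KNeighbours? X z′))
        y∈K , z′~y , y∉X = ∈-setOf⁻ (KNeighbours? X z′) y∈new
    in y , y∈K , z′~y , y∉X , λ z~y → y∉old (∈-setOf⁺ (KNeighbours? X z) (y∈K , z~y , y∉X))

  module _ (no-witness : ¬ Σ (Fin n) (Witness G s K)) where

    K-neighbour : ∀ {z} → ¬ InN[] G s z → ∃ λ k → k ∈ K × z ~ k
    K-neighbour {z} z∉N[s] = decidable-stable (any? λ k → k ∈? K ×-dec z ~? k) λ none →
      no-witness (z , Equivalence.from witness⇔ (z∉N[s] , λ k∈K k~z → none (_ , k∈K , ~-sym k~z)))

    sun-from-two-pendants : ∀ {z₁ a z₂ c} → Candidate z₁ → a ∈ K → z₁ ~ a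
      → Candidate z₂ → ¬ a ~ z₂ → c ∈ K → z₂ ~ c → ¬ z₁ ~ c
      → (∀ {y} → Candidate y × ¬ a ~ y → ¬ KNeighbours (neighbours z₁) y ⊂ KNeighbours (neighbours z₁) z₂)
      → InducedCopy SunAdj (GsAdj G s)
    sun-from-two-pendants {z₁} {a} {z₂} {c} z₁-candidate a∈K z₁~a z₂-candidate a≁z₂ c∈K z₂~c z₁≁c z₂-minimal =
      let a≢c = ~∧≁⇒≢ z₁~a z₁≁c
          w , a≁w , c≁w = Gs-inner (inj₂ (K⊆N[s] a∈K)) (inj₂ (K⊆N[s] c∈K)) (K-clique a c a∈K c∈K a≢c)
          z₃ , z₃-candidate , a≁z₃ , c≁z₃ =
            candidate-avoiding-pair a∈K c∈K (common-non-neighbour-outside a∈K c∈K a≢c a≁w c≁w) a≁w c≁w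
          d , d∈K , z₃~d , d∉N[z₁] , z₂≁d =
            escape (z₂-minimal (z₃-candidate , a≁z₃)) c∈K z₂~c (z₁≁c ∘ ∈-setOf⁻ (z₁ ~?_)) (c≁z₃ ∘ ~-sym)
      in sun-from-pendants (lookup (a ∷ c ∷ d ∷ [])) (lookup (z₁ ∷ z₂ ∷ z₃ ∷ []))
           (λ { 0F → a∈K ; 1F → c∈K ; 2F → d∈K })
           (λ { 0F → z₁-candidate ; 1F → z₂-candidate ; 2F → z₃-candidate })
           (λ { 0F → z₁~a ; 1F → z₂~c ; 2F → z₃~d })
           (λ { 0F 0F 0≢0 → contradiction refl 0≢0 ; 0F 1F _ → z₁≁c ; 0F 2F _ → d∉N[z₁] ∘ ∈-setOf⁺ (z₁ ~?_)
              ; 1F 0F _ → a≁z₂ ∘ ~-sym ; 1F 1F 1≢1 → contradiction refl 1≢1 ; 1F 2F _ → z₂≁d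
              ; 2F 0F _ → a≁z₃ ∘ ~-sym ; 2F 1F _ → c≁z₃ ∘ ~-sym ; 2F 2F 2≢2 → contradiction refl 2≢2 })

    part-ii : InducedCopy SunAdj (GsAdj G s)
    part-ii =
      let z₁ , z₁-candidate , z₁-minimal = ⊂-minimal candidate? (KNeighbours ⊥) some-candidate
          a , a∈K , z₁~a = K-neighbour (proj₁ z₁-candidate)
          z₂ , (z₂-candidate , a≁z₂) , z₂-minimal =
            ⊂-minimal (λ z → candidate? z ×-dec ¬? (a ~? z)) (KNeighbours (neighbours z₁))
                      (candidate-avoiding-one a∈K)
          c , c∈K , z₂~c , _ , z₁≁c = escape (z₁-minimal z₂-candidate) a∈K z₁~a ∉⊥ (a≁z₂ ∘ ~-sym)
      in sun-from-two-pendants z₁-candidate a∈K z₁~a z₂-candidate a≁z₂ c∈K z₂~c z₁≁c z₂-minimal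

lemma3p4 : (G : Graph) → Chordal G → NoUniversalVertex G
    → (s : Fin (Graph.n G)) → Simplicial G s
    → (K : Subset (Graph.n G)) → GsClique G s K
    → (∀ {x} → x ∈ K → InN G s x)
    → (Σ (Fin (Graph.n G)) (Witness G s K)
         → Σ (Fin (Graph.n G)) (λ w → Witness G s K w × Simplicial G w))
      × (¬ Σ (Fin (Graph.n G)) (Witness G s K)
         → InducedCopy SunAdj (GsAdj G s))
lemma3p4 G chordal no-universal s s-simplicial K K-clique K⊆N[s] =
  part-i , part-ii
  where open Lemma3p4 G chordal no-universal s s-simplicial K K-clique K⊆N[s]
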